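{- For $n\geq 2$, the number of permutations $\pi\in\mathcal{S}_n$ such that $\pi^2$ has exactly one descent and that descent is at position $n-1$ equals \[\sum_{i=1}^{\lfloor\frac{n-1}{2}\rfloor} e_{n-(2i+1)},\] where $e_j$ denotes the number of involutions in $\mathcal{S}_j$ (with $e_0=1$).
   Context: $\mathcal{S}_n$ is the symmetric group on $[n]$; a permutation $\sigma=\sigma_1\cdots\sigma_n$ (one-line notation) has a descent at position $i\in[n-1]$ if $\sigma_i>\sigma_{i+1}$. $\pi^2(i)=\pi(\pi(i))$. An involution is a permutation $\tau$ with $\tau^2$ the identity. -}

module Defs where

open import Data.Nat using (ℕ; zero; suc; _+_; _∸_; _/_; _<ᵇ_)
open import Data.Bool using (Bool; true; false; if_then_else_)
open import Data.Fin using (Fin; toℕ)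
open import Data.Fin.Properties using () renaming (_≟_ to _≟F_)
open import Data.Vec using (Vec; []; _∷_; lookup; tabulate; allFin; toList)
open import Data.Vec.Properties using () renaming (≡-dec to vec-≡-dec)
open import Data.List using (List; []; _∷_; concatMap; map; filter; length; upTo)
open import Data.Nat.ListAction using (sum)
open import Data.List.Relation.Unary.Unique.Propositional using (Unique)
import Data.List.Relation.Unary.Unique.DecPropositional as UDec
open import Data.List.Properties using () renaming (≡-dec to list-≡-dec)
open import Relation.Binary.PropositionalEquality using (_≡_)
open import Relation.Nullary using (Dec)
open import Relation.Nullary.Decidable using (_×-dec_)
open import Data.Product using (_×_)

-- Permutations of [n] in one-line notation: a vector of length n over Fin n
-- (0-based: entry at index i is σ(i+1) - 1) whose entries are pairwise distinct.

allVecs : (m k : ℕ) → List (Vec (Fin m) k)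
allVecs m zero = [] ∷ []
allVecs m (suc k) = concatMap (λ x → map (x ∷_) (allVecs m k)) (toList (allFin m))

IsPerm : {n : ℕ} → Vec (Fin n) n → Set
IsPerm v = Unique (toList v)

isPerm? : {n : ℕ} → (v : Vec (Fin n) n) → Dec (IsPerm v)
isPerm? v = UDec.unique? _≟F_ (toList v)

perms : (n : ℕ) → List (Vec (Fin n) n)
perms n = filter isPerm? (allVecs n n)

square : {n : ℕ} → Vec (Fin n) n → Vec (Fin n) n
square v = tabulate (λ i → lookup v (lookup v i))

idPerm : (n : ℕ) → Vec (Fin n) n
idPerm n = allFin n

-- descent positions (1-based) of a word a_1 a_2 ... : those i with a_i > a_{i+1};
-- 'descentsFrom p w' lists them for a word whose first letter sits at position p.
descentsFrom : ℕ → List ℕ → List ℕ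
descentsFrom p [] = []
descentsFrom p (a ∷ []) = []
descentsFrom p (a ∷ b ∷ w) =
  if b <ᵇ a then p ∷ descentsFrom (suc p) (b ∷ w) else descentsFrom (suc p) (b ∷ w)

Des : {n : ℕ} → Vec (Fin n) n → List ℕ
Des v = descentsFrom 1 (map toℕ (toList v))

Good : (n : ℕ) → Vec (Fin n) n → Set
Good n π = Des (square π) ≡ (n ∸ 1) ∷ []

good? : (n : ℕ) → (π : Vec (Fin n) n) → Dec (Good n π)
good? n π = list-≡-dec Data.Nat._≟_ (Des (square π)) ((n ∸ 1) ∷ [])

countGood : ℕ → ℕ
countGood n = length (filter (good? n) (perms n))

IsInvolution : {n : ℕ} → Vec (Fin n) n → Set
IsInvolution {n} τ = square τ ≡ idPerm n

isInvolution? : {n : ℕ} → (τ : Vec (Fin n) n) → Dec (IsInvolution τ)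
isInvolution? {n} τ = vec-≡-dec _≟F_ (square τ) (idPerm n)

e : ℕ → ℕ
e j = length (filter isInvolution? (perms j))

-- Σ_{i=1}^{⌊(n-1)/2⌋} e_{n-(2i+1)}
-- (upTo m = [0,…,m-1], so i = k+1 for k ∈ upTo ⌊(n-1)/2⌋)
rhs : ℕ → ℕ
rhs n = sum (map (λ k → e (n ∸ (2 * suc k + 1))) (upTo ((n ∸ 1) / 2)))
  where open Data.Nat using (_*_)

{-# OPTIONS --safe #-}
-- If π² has its only descent at position n − 1, then, being a permutation, it is
-- 1 2 ⋯ j (j+2) ⋯ n (j+1): it fixes [j] and is an m-cycle c on the last m = n − j ≥ 2
-- points. Since π commutes with π², it preserves the fixed points of π² and is an
-- involution on them, while on the block it commutes with c and so is a rotation c^p.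
-- Then c^{2p} = c gives 2p ≡ 1 (mod m), so m = 2i + 1 is odd with i ≥ 1 and p = i + 1.
-- Conversely any involution of [n − m] together with c^{(m+1)/2} on the block is such a π,
-- so for each i these π are in bijection with the involutions of S_{n−2i−1}.
module Submission where

open import Defs
open import Data.Nat using (ℕ; zero; suc; _+_; _*_; _∸_; _/_; _≤_; _<_; _<ᵇ_; z≤n; s≤s; z<s; s<s; s≤s⁻¹; _<?_; _≟_; NonZero; >-nonZero; >-nonZero⁻¹)
open import Data.Nat.Properties
open import Data.Nat.DivMod using (_%_; m<n⇒m%n≡m; n%n≡0; %-congˡ; m%n<n; m%n%n≡m%n; %-distribˡ-+; [m+n]%n≡m%n; m≤n⇒[n∸m]%m≡n%m; m/n*n≤m; m*n/n≡m; /-monoˡ-≤)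
open import Data.Nat.ListAction using (sum)
open import Data.Bool using (true; false)
open import Data.Fin using (Fin; toℕ; fromℕ<) renaming (zero to fzero; suc to fsuc)
open import Data.Fin.Properties using (toℕ<n; toℕ-fromℕ<; toℕ-injective)
open import Data.Vec using (Vec; []; _∷_; lookup; tabulate; allFin; toList)
open import Data.Vec.Properties using (lookup∘tabulate; ∷-injective)
open import Data.Vec.Membership.Propositional.Properties using (∈-toList⁺; ∈-allFin⁺; ∈-lookup)
open import Data.List using (List; []; _∷_; [_]; _++_; map; filter; length; upTo; concatMap; cartesianProductWith)
open import Data.List.Properties using (length-map; filter-accept; filter-reject; map-cong; map-cong-local; ∷-injectiveˡ)
open import Data.List.Membership.Propositional using (_∈_)
open import Data.List.Membership.Propositional.Properties using (∈-map⁺; ∈-map⁻; ∈-concatMap⁺; ∈-filter⁺; ∈-filter⁻; ∈-upTo⁺; ∈-upTo⁻)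
open import Data.List.Membership.Propositional.Properties.WithK using (unique∧set⇒bag)
open import Data.List.Relation.Unary.Any as Any using (here; there)
open import Data.List.Relation.Unary.All as All using ()
open import Data.List.Relation.Unary.Unique.Propositional using (Unique; []; _∷_)
import Data.List.Relation.Unary.Unique.Propositional.Properties as Unique
open import Data.List.Relation.Binary.BagAndSetEquality using (∼bag⇒↭)
open import Data.List.Relation.Binary.Permutation.Propositional.Properties using (↭-length)
open import Data.Product using (∃; _×_; _,_; proj₁; proj₂)
open import Data.Sum using (_⊎_; inj₁; inj₂)
open import Algebra.Properties.CommutativeSemigroup +-commutativeSemigroup using (interchange)
open import Function using (_∘_; flip)
open import Function.Bundles using (mk⇔)
open import Level using (0ℓ)
open import Relation.Binary.PropositionalEquality using (_≡_; _≢_; refl; sym; trans; cong; cong₂; subst; subst₂; module ≡-Reasoning)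
open import Relation.Nullary using (Dec; yes; no; ¬_)
open import Relation.Nullary.Decidable using (_×-dec_)
open import Relation.Nullary.Negation using (contradiction)
open import Relation.Nullary.Reflects using (ofʸ; ofⁿ)
open import Relation.Unary using (Pred; Decidable)

-- Counting by bijections and by fibres

length-≡-by-bijection : ∀ {A B : Set} {xs : List A} {ys : List B} (f : B → A) →
  Unique xs → Unique ys → (∀ {y y′} → f y ≡ f y′ → y ≡ y′) →
  (∀ {y} → y ∈ ys → f y ∈ xs) → (∀ {x} → x ∈ xs → ∃ λ y → y ∈ ys × f y ≡ x) →
  length xs ≡ length ys
length-≡-by-bijection {ys = ys} f xs! ys! f-inj f-into f-onto =
  trans (↭-length (∼bag⇒↭ (unique∧set⇒bag xs! (Unique.map⁺ f-inj ys!) (mk⇔ to from))))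
        (length-map f ys)
  where
  to : ∀ {x} → x ∈ _ → x ∈ map f ys
  to x∈xs with y , y∈ys , refl ← f-onto x∈xs = ∈-map⁺ f y∈ys
  from : ∀ {x} → x ∈ map f ys → x ∈ _
  from x∈fys with y , y∈ys , refl ← ∈-map⁻ f x∈fys = f-into y∈ys

sum-map-+ : ∀ {A : Set} (f g : A → ℕ) xs →
  sum (map (λ x → f x + g x) xs) ≡ sum (map f xs) + sum (map g xs)
sum-map-+ f g [] = refl
sum-map-+ f g (x ∷ xs) = trans (cong (f x + g x +_) (sum-map-+ f g xs)) (interchange (f x) (g x) _ _)

length-filter-∷ : ∀ {A : Set} {P : Pred A 0ℓ} (P? : Decidable P) x xs →
  length (filter P? (x ∷ xs)) ≡ length (filter P? [ x ]) + length (filter P? xs)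
length-filter-∷ P? x xs with P? x
... | yes _ = refl
... | no _ = refl

module Fibres {A : Set} {P : Pred A 0ℓ} (P? : Decidable P)
  (key : A → ℕ) (g : ℕ → ℕ) (g-inj : ∀ {k k′} → g k ≡ g k′ → k ≡ k′) where

  InFibre : ℕ → Pred A 0ℓ
  InFibre k x = P x × key x ≡ g k

  inFibre? : ∀ k → Decidable (InFibre k)
  inFibre? k x = P? x ×-dec (key x ≟ g k)

  private
    count : ℕ → A → ℕ
    count k x = length (filter (inFibre? k) [ x ])

    count-outside : ∀ {x} ks → (∀ {k} → k ∈ ks → ¬ InFibre k x) →
      sum (map (λ k → count k x) ks) ≡ 0
    count-outside [] _ = refl
    count-outside (k ∷ ks) ∉ks =
      cong₂ _+_ (cong length (filter-reject (inFibre? k) (∉ks (here refl))))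
                (count-outside ks (∉ks ∘ there))

    fibre-unique : ∀ {x k k′} → InFibre k x → InFibre k′ x → k ≡ k′
    fibre-unique (_ , eq) (_ , eq′) = g-inj (trans (sym eq) eq′)

    count-inside : ∀ {x k₀ ks} → Unique ks → k₀ ∈ ks → InFibre k₀ x →
      sum (map (λ k → count k x) ks) ≡ 1
    count-inside {ks = k ∷ ks} (k≢ks ∷ _) (here refl) x∈k =
      cong₂ _+_ (cong length (filter-accept (inFibre? k) x∈k))
                (count-outside ks λ k′∈ks x∈k′ → All.lookup k≢ks k′∈ks (fibre-unique x∈k x∈k′))
    count-inside {ks = k ∷ ks} (k≢ks ∷ ks!) (there k₀∈ks) x∈k₀ =
      cong₂ _+_ (cong length (filter-reject (inFibre? k) λ x∈k →
                   All.lookup k≢ks k₀∈ks (fibre-unique x∈k x∈k₀)))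
                (count-inside ks! k₀∈ks x∈k₀)

    sum-count : ∀ x {ks} → Unique ks → (P x → ∃ λ k → k ∈ ks × key x ≡ g k) →
      sum (map (λ k → count k x) ks) ≡ length (filter P? [ x ])
    sum-count x {ks} ks! covered = by-cases (P? x)
      where
      by-cases : Dec (P x) → sum (map (λ k → count k x) ks) ≡ length (filter P? [ x ])
      by-cases (yes Px) = let k , k∈ks , eq = covered Px in
        trans (count-inside ks! k∈ks (Px , eq)) (sym (cong length (filter-accept P? Px)))
      by-cases (no ¬Px) =
        trans (count-outside ks λ _ → ¬Px ∘ proj₁) (sym (cong length (filter-reject P? ¬Px)))

  length-filter≡sum-fibres : ∀ {ks} → Unique ks → ∀ xs →
    (∀ {x} → x ∈ xs → P x → ∃ λ k → k ∈ ks × key x ≡ g k) →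
    length (filter P? xs) ≡ sum (map (λ k → length (filter (inFibre? k) xs)) ks)
  length-filter≡sum-fibres {ks} ks! [] _ = sym (sum-zeros ks)
    where
    sum-zeros : ∀ ks → sum (map (λ k → length (filter (inFibre? k) [])) ks) ≡ 0
    sum-zeros [] = refl
    sum-zeros (_ ∷ ks) = sum-zeros ks
  length-filter≡sum-fibres {ks} ks! (x ∷ xs) covered = begin
    length (filter P? (x ∷ xs))
      ≡⟨ length-filter-∷ P? x xs ⟩
    length (filter P? [ x ]) + length (filter P? xs)
      ≡⟨ cong₂ _+_ (sym (sum-count x ks! (covered (here refl))))
                   (length-filter≡sum-fibres ks! xs (covered ∘ there)) ⟩
    sum (map (λ k → count k x) ks) + sum (map (λ k → length (filter (inFibre? k) xs)) ks)
      ≡⟨ sym (sum-map-+ (λ k → count k x) _ ks) ⟩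
    sum (map (λ k → count k x + length (filter (inFibre? k) xs)) ks)
      ≡⟨ cong sum (map-cong (λ k → sym (length-filter-∷ (inFibre? k) x xs)) ks) ⟩
    sum (map (λ k → length (filter (inFibre? k) (x ∷ xs))) ks) ∎
    where open ≡-Reasoning

-- The entries of a vector as a function on ℕ (junk value 0 past the end), so that
-- index arithmetic can be done in ℕ.
at : ∀ {m k} → Vec (Fin m) k → ℕ → ℕ
at [] _ = 0
at (x ∷ _) zero = toℕ x
at (_ ∷ v) (suc i) = at v i

at-lookup : ∀ {m k} (v : Vec (Fin m) k) (i : Fin k) → at v (toℕ i) ≡ toℕ (lookup v i)
at-lookup (x ∷ v) fzero = refl
at-lookup (x ∷ v) (fsuc i) = at-lookup v i

at-fromℕ< : ∀ {m k} (v : Vec (Fin m) k) {i} (i<k : i < k) → at v i ≡ toℕ (lookup v (fromℕ< i<k))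
at-fromℕ< v i<k = trans (cong (at v) (sym (toℕ-fromℕ< i<k))) (at-lookup v (fromℕ< i<k))

at< : ∀ {m k} (v : Vec (Fin m) k) {i} → i < k → at v i < m
at< (x ∷ v) {zero} _ = toℕ<n x
at< (x ∷ v) {suc i} (s<s i<k) = at< v i<k

at-ext : ∀ {m k} (v w : Vec (Fin m) k) → (∀ {i} → i < k → at v i ≡ at w i) → v ≡ w
at-ext [] [] _ = refl
at-ext (x ∷ v) (y ∷ w) v≗w = cong₂ _∷_ (toℕ-injective (v≗w z<s)) (at-ext v w (v≗w ∘ s<s))

at-tabulate : ∀ {m k} (f : Fin k → Fin m) {i} (i<k : i < k) → at (tabulate f) i ≡ toℕ (f (fromℕ< i<k))
at-tabulate f i<k = trans (at-fromℕ< (tabulate f) i<k) (cong toℕ (lookup∘tabulate f (fromℕ< i<k)))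

at-square : ∀ {n} (v : Vec (Fin n) n) {i} → i < n → at (square v) i ≡ at v (at v i)
at-square v i<n = trans (at-tabulate _ i<n)
  (trans (sym (at-lookup v _)) (cong (at v) (sym (at-fromℕ< v i<n))))

at-allFin : ∀ k {i} → i < k → at (allFin k) i ≡ i
at-allFin k i<k = trans (at-tabulate (λ x → x) i<k) (toℕ-fromℕ< i<k)

toFinOr : ∀ {a} → Fin a → ℕ → Fin a
toFinOr {a} default x with x <? a
... | yes x<a = fromℕ< x<a
... | no _ = default

toℕ-toFinOr : ∀ {a} (default : Fin a) {x} → x < a → toℕ (toFinOr default x) ≡ x
toℕ-toFinOr {a} default {x} x<a with x <? a
... | yes x<a′ = toℕ-fromℕ< x<a′
... | no x≮a = contradiction x<a x≮a

-- Values f i ≥ a are replaced by the junk value i.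
fromFunction : (a : ℕ) → (ℕ → ℕ) → Vec (Fin a) a
fromFunction a f = tabulate λ i → toFinOr i (f (toℕ i))

at-fromFunction : ∀ a f {i} → i < a → f i < a → at (fromFunction a f) i ≡ f i
at-fromFunction a f i<a fi<a = trans (at-tabulate _ i<a)
  (trans (toℕ-toFinOr _ (subst (λ x → f x < a) (sym (toℕ-fromℕ< i<a)) fi<a))
         (cong f (toℕ-fromℕ< i<a)))

MapsInto : ℕ → (ℕ → ℕ) → Set
MapsInto n f = ∀ {i} → i < n → f i < n

InjectiveOn : ℕ → (ℕ → ℕ) → Set
InjectiveOn n f = ∀ {i i′} → i < n → i′ < n → f i ≡ f i′ → i ≡ i′

private
  lookup∈ : ∀ {m k} (v : Vec (Fin m) k) {i} (i<k : i < k) → lookup v (fromℕ< i<k) ∈ toList v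
  lookup∈ v i<k = ∈-toList⁺ (∈-lookup (fromℕ< i<k) v)

  ∈⇒at : ∀ {m k} (v : Vec (Fin m) k) {y} → y ∈ toList v → ∃ λ i → i < k × at v i ≡ toℕ y
  ∈⇒at (x ∷ v) (here refl) = 0 , z<s , refl
  ∈⇒at (x ∷ v) (there y∈v) = let i , i<k , eq = ∈⇒at v y∈v in suc i , s<s i<k , eq

unique⇒injectiveOn : ∀ {m k} (v : Vec (Fin m) k) → Unique (toList v) → InjectiveOn k (at v)
unique⇒injectiveOn (x ∷ v) (x∉v ∷ v!) {zero} {zero} _ _ _ = refl
unique⇒injectiveOn (x ∷ v) (x∉v ∷ v!) {zero} {suc i′} _ (s<s i′<k) eq =
  contradiction (toℕ-injective (trans eq (at-fromℕ< v i′<k))) (All.lookup x∉v (lookup∈ v i′<k))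
unique⇒injectiveOn (x ∷ v) (x∉v ∷ v!) {suc i} {zero} (s<s i<k) _ eq =
  contradiction (toℕ-injective (trans (sym eq) (at-fromℕ< v i<k))) (All.lookup x∉v (lookup∈ v i<k))
unique⇒injectiveOn (x ∷ v) (x∉v ∷ v!) {suc i} {suc i′} (s<s i<k) (s<s i′<k) eq =
  cong suc (unique⇒injectiveOn v v! i<k i′<k eq)

injectiveOn⇒unique : ∀ {m k} (v : Vec (Fin m) k) → InjectiveOn k (at v) → Unique (toList v)
injectiveOn⇒unique [] _ = []
injectiveOn⇒unique (x ∷ v) inj =
  All.tabulate (λ y∈v x≡y → let i , i<k , eq = ∈⇒at v y∈v in
    0≢1+n (inj z<s (s<s i<k) (trans (cong toℕ x≡y) (sym eq))))
  ∷ injectiveOn⇒unique v λ i<k i′<k eq → suc-injective (inj (s<s i<k) (s<s i′<k) eq)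

allVecs-complete : ∀ m k (v : Vec (Fin m) k) → v ∈ allVecs m k
allVecs-complete m zero [] = here refl
allVecs-complete m (suc k) (x ∷ v) =
  ∈-concatMap⁺ _ (Any.map (λ { refl → ∈-map⁺ (x ∷_) (allVecs-complete m k v) })
                          (∈-toList⁺ (∈-allFin⁺ x)))

concatMap-map≡cartesianProductWith : ∀ {A B C : Set} (f : A → B → C) xs ys →
  concatMap (λ x → map (f x) ys) xs ≡ cartesianProductWith f xs ys
concatMap-map≡cartesianProductWith f [] ys = refl
concatMap-map≡cartesianProductWith f (x ∷ xs) ys =
  cong (map (f x) ys ++_) (concatMap-map≡cartesianProductWith f xs ys)

allVecs-unique : ∀ m k → Unique (allVecs m k)
allVecs-unique m zero = All.[] ∷ []
allVecs-unique m (suc k) =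
  subst Unique (sym (concatMap-map≡cartesianProductWith _∷_ (toList (allFin m)) (allVecs m k)))
    (Unique.cartesianProductWith⁺ _∷_ ∷-injective allFin-unique (allVecs-unique m k))
  where
  allFin-unique : Unique (toList (allFin m))
  allFin-unique = injectiveOn⇒unique (allFin m) λ i<m i′<m eq →
    trans (sym (at-allFin m i<m)) (trans eq (at-allFin m i′<m))

perms-unique : ∀ n → Unique (perms n)
perms-unique n = Unique.filter⁺ isPerm? (allVecs-unique n n)

∈-perms⁺ : ∀ {n} {v : Vec (Fin n) n} → IsPerm v → v ∈ perms n
∈-perms⁺ {n} {v} = ∈-filter⁺ isPerm? (allVecs-complete n n v)

∈-perms⁻ : ∀ {n} {v : Vec (Fin n) n} → v ∈ perms n → IsPerm v
∈-perms⁻ {n} v∈ = proj₂ (∈-filter⁻ isPerm? {xs = allVecs n n} v∈)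

-- Permutations with a single descent, at the last position

SoleDescentAt : ℕ → (ℕ → ℕ) → Set
SoleDescentAt k f = (∀ {i} → i < k → f i ≤ f (suc i)) × f (suc k) < f k

private
  entries : ∀ {m k} → Vec (Fin m) k → List ℕ
  entries v = map toℕ (toList v)

descentsFrom≡[p+k]⇒soleDescentAt : ∀ {m} p k (v : Vec (Fin m) (suc (suc k))) →
  descentsFrom p (entries v) ≡ (p + k) ∷ [] → SoleDescentAt k (at v)
descentsFrom≡[p+k]⇒soleDescentAt p zero (a ∷ b ∷ []) eq
  with toℕ b <ᵇ toℕ a | <ᵇ-reflects-< (toℕ b) (toℕ a)
... | true | ofʸ b<a = (λ ()) , b<a
descentsFrom≡[p+k]⇒soleDescentAt p (suc k) (a ∷ b ∷ c ∷ v) eq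
  with toℕ b <ᵇ toℕ a | <ᵇ-reflects-< (toℕ b) (toℕ a)
... | true | _ = contradiction (∷-injectiveˡ eq) (m+1+n≢m p ∘ sym)
... | false | ofⁿ b≮a =
  let ascending , drop = descentsFrom≡[p+k]⇒soleDescentAt (suc p) k (b ∷ c ∷ v)
                           (trans eq (cong (_∷ []) (+-suc p k)))
  in (λ { {zero} _ → ≮⇒≥ b≮a ; {suc i} (s<s i<k) → ascending i<k }) , drop

soleDescentAt⇒descentsFrom≡[p+k] : ∀ {m} p k (v : Vec (Fin m) (suc (suc k))) →
  SoleDescentAt k (at v) → descentsFrom p (entries v) ≡ (p + k) ∷ []
soleDescentAt⇒descentsFrom≡[p+k] p zero (a ∷ b ∷ []) (_ , b<a)
  with toℕ b <ᵇ toℕ a | <ᵇ-reflects-< (toℕ b) (toℕ a)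
... | true | _ = cong (_∷ []) (sym (+-identityʳ p))
... | false | ofⁿ b≮a = contradiction b<a b≮a
soleDescentAt⇒descentsFrom≡[p+k] p (suc k) (a ∷ b ∷ c ∷ v) (ascending , drop)
  with toℕ b <ᵇ toℕ a | <ᵇ-reflects-< (toℕ b) (toℕ a)
... | true | ofʸ b<a = contradiction b<a (≤⇒≯ (ascending z<s))
... | false | _ =
  trans (soleDescentAt⇒descentsFrom≡[p+k] (suc p) k (b ∷ c ∷ v) ((ascending ∘ s<s) , drop))
        (cong (_∷ []) (sym (+-suc p k)))

soleDescentAt-cong : ∀ {k f g} → (∀ {i} → i < suc (suc k) → f i ≡ g i) →
  SoleDescentAt k f → SoleDescentAt k g
soleDescentAt-cong {k} f≗g (weakly-ascending , drop) =
  (λ i<k → subst₂ _≤_ (f≗g (m<n⇒m<1+n (m<n⇒m<1+n i<k))) (f≗g (s<s (m<n⇒m<1+n i<k)))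
                      (weakly-ascending i<k)) ,
  subst₂ _<_ (f≗g ≤-refl) (f≗g (m<n⇒m<1+n (n<1+n k))) drop

-- s = 1 2 ⋯ j (j+2) ⋯ n (j+1) in one-line notation, read 0-based with n = n′ + 2.
IsTailCycle : ℕ → ℕ → (ℕ → ℕ) → Set
IsTailCycle n′ j s =
  (∀ {i} → i < j → s i ≡ i) × (∀ {i} → j ≤ i → i ≤ n′ → s i ≡ suc i) × s (suc n′) ≡ j

module _ {n′ : ℕ} {s : ℕ → ℕ} (s-into : MapsInto (suc (suc n′)) s)
         (s-inj : InjectiveOn (suc (suc n′)) s) (sole : SoleDescentAt n′ s) where

  private
    ≤⇒<2+ : ∀ {i} → i ≤ n′ → i < suc (suc n′)
    ≤⇒<2+ i≤n′ = s≤s (m≤n⇒m≤1+n i≤n′)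

    weakly-ascending : ∀ {i} → i < n′ → s i ≤ s (suc i)
    weakly-ascending = proj₁ sole

    drop : s (suc n′) < s n′
    drop = proj₂ sole

    ascending : ∀ {i} → i < n′ → s i < s (suc i)
    ascending i<n′ = ≤∧≢⇒< (weakly-ascending i<n′)
      λ eq → 1+n≢n (sym (s-inj (≤⇒<2+ (<⇒≤ i<n′)) (≤⇒<2+ i<n′) eq))

    gap : ∀ i d → i + d ≤ n′ → s i + d ≤ s (i + d)
    gap i zero _ rewrite +-identityʳ i | +-identityʳ (s i) = ≤-refl
    gap i (suc d) i+d<n′ rewrite +-suc i d | +-suc (s i) d =
      ≤-trans (s≤s (gap i d (<⇒≤ i+d<n′))) (ascending i+d<n′)

    above-index : ∀ {i} → i ≤ n′ → i ≤ s i
    above-index {i} i≤n′ = ≤-trans (m≤n+m i (s 0)) (gap 0 i i≤n′)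

    below-successor : ∀ {i} → i ≤ n′ → s i ≤ suc i
    below-successor {i} i≤n′ = +-cancelʳ-≤ d (s i) (suc i) (begin
      s i + d        ≤⟨ gap i d (≤-reflexive i+d≡n′) ⟩
      s (i + d)      ≡⟨ cong s i+d≡n′ ⟩
      s n′           ≤⟨ s≤s⁻¹ (s-into (≤⇒<2+ ≤-refl)) ⟩
      suc n′         ≡⟨ cong suc (sym i+d≡n′) ⟩
      suc (i + d)    ∎)
      where
      open ≤-Reasoning
      d = n′ ∸ i
      i+d≡n′ : i + d ≡ n′
      i+d≡n′ = m+[n∸m]≡n i≤n′

    last≤n′ : s (suc n′) ≤ n′
    last≤n′ = s≤s⁻¹ (<-≤-trans drop (below-successor ≤-refl))

    ≢last : ∀ {i} → i ≤ n′ → s i ≢ s (suc n′)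
    ≢last i≤n′ eq = <-irrefl (s-inj (≤⇒<2+ i≤n′) ≤-refl eq) (s≤s i≤n′)

  soleDescentAt⇒isTailCycle : s (suc n′) ≤ n′ × IsTailCycle n′ (s (suc n′)) s
  soleDescentAt⇒isTailCycle = last≤n′ , fixed , shifted , refl
    where
    open ≤-Reasoning
    j = s (suc n′)

    fixed : ∀ {i} → i < j → s i ≡ i
    fixed {i} i<j = ≤-antisym (+-cancelʳ-≤ d (s i) i (begin
      s i + d    ≤⟨ gap i d i+d≤n′ ⟩
      s (i + d)  ≤⟨ s≤s⁻¹ (≤∧≢⇒< (below-successor i+d≤n′) (≢last i+d≤n′ ∘ flip trans 1+i+d≡j)) ⟩
      i + d      ∎)) (above-index (≤-trans (<⇒≤ i<j) last≤n′))
      where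
      d = j ∸ suc i
      1+i+d≡j : suc (i + d) ≡ j
      1+i+d≡j = m+[n∸m]≡n i<j
      i+d≤n′ : i + d ≤ n′
      i+d≤n′ = ≤-trans (n≤1+n _) (subst (_≤ n′) (sym 1+i+d≡j) last≤n′)

    shifted : ∀ {i} → j ≤ i → i ≤ n′ → s i ≡ suc i
    shifted {i} j≤i i≤n′ = ≤-antisym (below-successor i≤n′) (begin
      suc i      ≡⟨ cong suc (sym j+d≡i) ⟩
      suc j + d  ≤⟨ +-monoˡ-≤ d j<sj ⟩
      s j + d    ≤⟨ gap j d (subst (_≤ n′) (sym j+d≡i) i≤n′) ⟩
      s (j + d)  ≡⟨ cong s j+d≡i ⟩
      s i        ∎)
      where
      d = i ∸ j
      j+d≡i : j + d ≡ i
      j+d≡i = m+[n∸m]≡n j≤i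
      j<sj : j < s j
      j<sj = ≤∧≢⇒< (above-index last≤n′) (≢last last≤n′ ∘ sym)

isTailCycle⇒soleDescentAt : ∀ {n′ j s} → j ≤ n′ → IsTailCycle n′ j s → SoleDescentAt n′ s
isTailCycle⇒soleDescentAt {n′} {j} {s} j≤n′ (fixed , shifted , last) = weakly-ascending , drop
  where
  between : ∀ {i} → i ≤ n′ → i ≤ s i × s i ≤ suc i
  between {i} i≤n′ with i <? j
  ... | yes i<j = ≤-reflexive (sym (fixed i<j)) , subst (_≤ suc i) (sym (fixed i<j)) (n≤1+n i)
  ... | no i≮j = let eq = shifted (≮⇒≥ i≮j) i≤n′ in
                  subst (i ≤_) (sym eq) (n≤1+n i) , ≤-reflexive eq

  weakly-ascending : ∀ {i} → i < n′ → s i ≤ s (suc i)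
  weakly-ascending i<n′ = ≤-trans (proj₂ (between (<⇒≤ i<n′))) (proj₁ (between i<n′))

  drop : s (suc n′) < s n′
  drop = subst₂ _<_ (sym last) (sym (shifted j≤n′ ≤-refl)) (s≤s j≤n′)

-- IsTailCycle in block coordinates i = j + t, with m = n − j.
BlockCycle : (j m : ℕ) .{{_ : NonZero m}} → (ℕ → ℕ) → Set
BlockCycle j m s = (∀ {i} → i < j → s i ≡ i) × (∀ {t} → t < m → s (j + t) ≡ j + suc t % m)

module _ {n′ j : ℕ} {s : ℕ → ℕ} (m : ℕ) .{{_ : NonZero m}} (j+m≡n : j + m ≡ suc (suc n′)) where

  isTailCycle⇒blockCycle : IsTailCycle n′ j s → BlockCycle j m s
  isTailCycle⇒blockCycle (fixed , shifted , last) = fixed , block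
    where
    block : ∀ {t} → t < m → s (j + t) ≡ j + suc t % m
    block {t} t<m with suc t <? m
    ... | yes 1+t<m = begin
      s (j + t)      ≡⟨ shifted (m≤m+n j t) (s≤s⁻¹ (s≤s⁻¹ j+1+t<n)) ⟩
      suc (j + t)    ≡⟨ sym (+-suc j t) ⟩
      j + suc t      ≡⟨ cong (j +_) (sym (m<n⇒m%n≡m 1+t<m)) ⟩
      j + suc t % m  ∎
      where
      open ≡-Reasoning
      j+1+t<n : suc (j + t) < suc (suc n′)
      j+1+t<n = subst₂ _<_ (+-suc j t) j+m≡n (+-monoʳ-< j 1+t<m)
    ... | no 1+t≮m = begin
      s (j + t)      ≡⟨ cong s (suc-injective (trans (sym (+-suc j t)) (trans (cong (j +_) 1+t≡m) j+m≡n))) ⟩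
      s (suc n′)     ≡⟨ last ⟩
      j              ≡⟨ sym (+-identityʳ j) ⟩
      j + 0          ≡⟨ cong (j +_) (sym (trans (%-congˡ 1+t≡m) (n%n≡0 m))) ⟩
      j + suc t % m  ∎
      where
      open ≡-Reasoning
      1+t≡m : suc t ≡ m
      1+t≡m = ≤-antisym t<m (≮⇒≥ 1+t≮m)

  blockCycle⇒isTailCycle : BlockCycle j m s → IsTailCycle n′ j s
  blockCycle⇒isTailCycle (fixed , block) = fixed , shifted , last
    where
    open ≡-Reasoning
    shifted : ∀ {i} → j ≤ i → i ≤ n′ → s i ≡ suc i
    shifted {i} j≤i i≤n′ = begin
      s i            ≡⟨ cong s (sym j+t≡i) ⟩
      s (j + t)      ≡⟨ block (<-trans (n<1+n t) 1+t<m) ⟩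
      j + suc t % m  ≡⟨ cong (j +_) (m<n⇒m%n≡m 1+t<m) ⟩
      j + suc t      ≡⟨ +-suc j t ⟩
      suc (j + t)    ≡⟨ cong suc j+t≡i ⟩
      suc i          ∎
      where
      t = i ∸ j
      j+t≡i : j + t ≡ i
      j+t≡i = m+[n∸m]≡n j≤i
      1+t<m : suc t < m
      1+t<m = +-cancelˡ-< j (suc t) m
        (subst₂ _<_ (trans (cong suc (sym j+t≡i)) (sym (+-suc j t))) (sym j+m≡n) (s≤s (s≤s i≤n′)))

    last : s (suc n′) ≡ j
    last = begin
      s (suc n′)     ≡⟨ cong s (sym j+t≡1+n′) ⟩
      s (j + t)      ≡⟨ block (subst (t <_) 1+t≡m ≤-refl) ⟩
      j + suc t % m  ≡⟨ cong (j +_) (trans (%-congˡ 1+t≡m) (n%n≡0 m)) ⟩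
      j + 0          ≡⟨ +-identityʳ j ⟩
      j              ∎
      where
      j≤1+n′ : j ≤ suc n′
      j≤1+n′ = s≤s⁻¹ (subst (suc j ≤_) j+m≡n
        (subst (_≤ j + m) (+-comm j 1) (+-monoʳ-≤ j (>-nonZero⁻¹ m))))
      t = suc n′ ∸ j
      j+t≡1+n′ : j + t ≡ suc n′
      j+t≡1+n′ = m+[n∸m]≡n j≤1+n′
      1+t≡m : suc t ≡ m
      1+t≡m = +-cancelˡ-≡ j (suc t) m (trans (+-suc j t) (trans (cong suc j+t≡1+n′) (sym j+m≡n)))

[m+n%d]%d≡[m+n]%d : ∀ m n d .{{_ : NonZero d}} → (m + n % d) % d ≡ (m + n) % d
[m+n%d]%d≡[m+n]%d m n d = begin
  (m + n % d) % d            ≡⟨ %-distribˡ-+ m (n % d) d ⟩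
  (m % d + n % d % d) % d    ≡⟨ cong (λ x → (m % d + x) % d) (m%n%n≡m%n n d) ⟩
  (m % d + n % d) % d        ≡⟨ %-distribˡ-+ m n d ⟨
  (m + n) % d                ∎
  where open ≡-Reasoning

rotate : (m : ℕ) .{{_ : NonZero m}} → ℕ → ℕ → ℕ
rotate m p t = (p + t) % m

rotate-into : ∀ m .{{_ : NonZero m}} p → MapsInto m (rotate m p)
rotate-into m p _ = m%n<n _ m

rotate-∘ : ∀ m .{{_ : NonZero m}} p q t → rotate m p (rotate m q t) ≡ rotate m (p + q) t
rotate-∘ m p q t = trans ([m+n%d]%d≡[m+n]%d p (q + t) m) (cong (_% m) (sym (+-assoc p q t)))

rotate-period : ∀ m .{{_ : NonZero m}} p t → rotate m (m + p) t ≡ rotate m p t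
rotate-period m p t = begin
  (m + p + t) % m    ≡⟨ cong (_% m) (trans (+-assoc m p t) (+-comm m (p + t))) ⟩
  (p + t + m) % m    ≡⟨ [m+n]%n≡m%n (p + t) m ⟩
  (p + t) % m        ∎
  where open ≡-Reasoning

_⊕[_]_ : (ℕ → ℕ) → ℕ → (ℕ → ℕ) → ℕ → ℕ
(f ⊕[ j ] g) i with i <? j
... | yes _ = f i
... | no _ = j + g (i ∸ j)

module _ {f g : ℕ → ℕ} where

  ⊕-< : ∀ {j i} → i < j → (f ⊕[ j ] g) i ≡ f i
  ⊕-< {j} {i} i<j with i <? j
  ... | yes _ = refl
  ... | no i≮j = contradiction i<j i≮j

  ⊕-+ : ∀ j t → (f ⊕[ j ] g) (j + t) ≡ j + g t
  ⊕-+ j t with j + t <? j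
  ... | yes j+t<j = contradiction j+t<j (≤⇒≯ (m≤m+n j t))
  ... | no _ = cong (λ x → j + g x) (m+n∸m≡n j t)

  ⊕-congˡ : ∀ {j f′} → (∀ {i} → i < j → f i ≡ f′ i) → ∀ i → (f ⊕[ j ] g) i ≡ (f′ ⊕[ j ] g) i
  ⊕-congˡ {j} f≗f′ i with i <? j
  ... | yes i<j = f≗f′ i<j
  ... | no _ = refl

split : ∀ j {m i} → i < j + m → i < j ⊎ ∃ λ t → t < m × j + t ≡ i
split j {m} {i} i<j+m with i <? j
... | yes i<j = inj₁ i<j
... | no i≮j = inj₂ (i ∸ j , +-cancelˡ-< j _ m (subst (_< j + m) (sym j+t≡i) i<j+m) , j+t≡i)
  where j+t≡i = m+[n∸m]≡n (≮⇒≥ i≮j)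

module _ {j m : ℕ} {f g : ℕ → ℕ} where

  ⊕-into : MapsInto j f → MapsInto m g → MapsInto (j + m) (f ⊕[ j ] g)
  ⊕-into f-into g-into i<j+m with split j i<j+m
  ... | inj₁ i<j = subst (_< j + m) (sym (⊕-< i<j)) (<-≤-trans (f-into i<j) (m≤m+n j m))
  ... | inj₂ (t , t<m , refl) = subst (_< j + m) (sym (⊕-+ j t)) (+-monoʳ-< j (g-into t<m))

  ⊕-∘ : ∀ {f′ g′} → MapsInto j f′ → MapsInto m g′ → ∀ {i} → i < j + m →
    (f ⊕[ j ] g) ((f′ ⊕[ j ] g′) i) ≡ ((f ∘ f′) ⊕[ j ] (g ∘ g′)) i
  ⊕-∘ {f′} {g′} f′-into g′-into i<j+m with split j i<j+m
  ... | inj₁ i<j = begin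
    (f ⊕[ j ] g) ((f′ ⊕[ j ] g′) _)  ≡⟨ cong (f ⊕[ j ] g) (⊕-< i<j) ⟩
    (f ⊕[ j ] g) (f′ _)              ≡⟨ ⊕-< (f′-into i<j) ⟩
    f (f′ _)                         ≡⟨ ⊕-< i<j ⟨
    ((f ∘ f′) ⊕[ j ] (g ∘ g′)) _     ∎
    where open ≡-Reasoning
  ... | inj₂ (t , t<m , refl) = begin
    (f ⊕[ j ] g) ((f′ ⊕[ j ] g′) (j + t))  ≡⟨ cong (f ⊕[ j ] g) (⊕-+ j t) ⟩
    (f ⊕[ j ] g) (j + g′ t)                ≡⟨ ⊕-+ j (g′ t) ⟩
    j + g (g′ t)                           ≡⟨ ⊕-+ j t ⟨
    ((f ∘ f′) ⊕[ j ] (g ∘ g′)) (j + t)     ∎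
    where open ≡-Reasoning

leftInverse⇒injectiveOn : ∀ {n F} G → (∀ {i} → i < n → G (F i) ≡ i) → InjectiveOn n F
leftInverse⇒injectiveOn G G∘F≗id i<n i′<n eq =
  trans (sym (G∘F≗id i<n)) (trans (cong G eq) (G∘F≗id i′<n))

-- Square roots of tail cycles

blockSize : ℕ → ℕ
blockSize k = 2 * suc k + 1

2≤blockSize : ∀ k → 2 ≤ blockSize k
2≤blockSize k = s≤s (m≤n+m 1 _)

blockSize-halves : ∀ k → suc k + suc (suc k) ≡ blockSize k
blockSize-halves k = begin
  suc k + suc (suc k)      ≡⟨ cong (suc k +_) (+-comm 1 (suc k)) ⟩
  suc k + (suc k + 1)      ≡⟨ +-assoc (suc k) (suc k) 1 ⟨
  suc k + suc k + 1        ≡⟨ cong (λ x → suc k + x + 1) (+-identityʳ (suc k)) ⟨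
  blockSize k              ∎
  where open ≡-Reasoning

blockSize-injective : ∀ {k k′} → blockSize k ≡ blockSize k′ → k ≡ k′
blockSize-injective {k} {k′} eq =
  suc-injective (*-cancelˡ-≡ (suc k) (suc k′) 2 (+-cancelʳ-≡ 1 (2 * suc k) (2 * suc k′) eq))

double≡1+m⇒blockSize : ∀ {p m} → 2 ≤ m → p + p ≡ suc m → ∃ λ k → p ≡ suc (suc k) × m ≡ blockSize k
double≡1+m⇒blockSize {suc zero} (s≤s ()) refl
double≡1+m⇒blockSize {suc (suc k)} _ eq = k , refl , trans (sym (suc-injective eq)) (blockSize-halves k)

module SquareRootOfBlockCycle {j m : ℕ} .{{_ : NonZero m}} (2≤m : 2 ≤ m) {F : ℕ → ℕ}
  (F-into : MapsInto (j + m) F) (F-inj : InjectiveOn (j + m) F)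
  (F²-blockCycle : BlockCycle j m (F ∘ F)) where

  private
    fixed : ∀ {i} → i < j → F (F i) ≡ i
    fixed = proj₁ F²-blockCycle

    block : ∀ {t} → t < m → F (F (j + t)) ≡ j + suc t % m
    block = proj₂ F²-blockCycle

    open ≡-Reasoning

    j<j+m : j < j + m
    j<j+m = subst (_≤ j + m) (+-comm j 1) (+-monoʳ-≤ j (≤-trans (s≤s z≤n) 2≤m))

    block-moved : ∀ {t} → t < m → F (F (j + t)) ≢ j + t
    block-moved {t} t<m eq with suc t <? m
    ... | yes 1+t<m = 1+n≢n (+-cancelˡ-≡ j _ _ (begin
      j + suc t      ≡⟨ cong (j +_) (m<n⇒m%n≡m 1+t<m) ⟨
      j + suc t % m  ≡⟨ block t<m ⟨
      F (F (j + t))  ≡⟨ eq ⟩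
      j + t          ∎))
    ... | no 1+t≮m = <⇒≱ (subst (_< 2) 1+t≡m (s≤s (s≤s (≤-reflexive t≡0)))) 2≤m
      where
      1+t≡m : suc t ≡ m
      1+t≡m = ≤-antisym t<m (≮⇒≥ 1+t≮m)
      t≡0 : t ≡ 0
      t≡0 = sym (+-cancelˡ-≡ j 0 t (begin
        j + 0          ≡⟨ cong (j +_) (trans (%-congˡ 1+t≡m) (n%n≡0 m)) ⟨
        j + suc t % m  ≡⟨ block t<m ⟨
        F (F (j + t))  ≡⟨ eq ⟩
        j + t          ∎))

    fixed⇒< : ∀ {i} → i < j + m → F (F i) ≡ i → i < j
    fixed⇒< i<j+m eq with split j i<j+m
    ... | inj₁ i<j = i<j
    ... | inj₂ (t , t<m , refl) = contradiction eq (block-moved t<m)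

  -- F commutes with F ∘ F, hence preserves its fixed points [0, j) and their complement.
  F-< : ∀ {i} → i < j → F i < j
  F-< i<j = fixed⇒< (F-into (<-≤-trans i<j (m≤m+n j m))) (cong F (fixed i<j))

  F-≥ : ∀ {i} → j ≤ i → i < j + m → j ≤ F i
  F-≥ j≤i i<j+m = ≮⇒≥ λ Fi<j →
    <⇒≱ (fixed⇒< i<j+m (F-inj (F-into (F-into i<j+m)) i<j+m (fixed Fi<j))) j≤i

  private
    p : ℕ
    p = F j ∸ j

    F-j : F j ≡ j + p
    F-j = sym (m+[n∸m]≡n (F-≥ ≤-refl j<j+m))

    p<m : p < m
    p<m = +-cancelˡ-< j p m (subst (_< j + m) F-j (F-into j<j+m))

    F-block : ∀ {t} → t < m → F (j + t) ≡ j + rotate m p t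
    F-block {zero} _ = begin
      F (j + 0)            ≡⟨ cong F (+-identityʳ j) ⟩
      F j                  ≡⟨ F-j ⟩
      j + p                ≡⟨ cong (j +_) (trans (cong (_% m) (+-identityʳ p)) (m<n⇒m%n≡m p<m)) ⟨
      j + rotate m p 0     ∎
    F-block {suc t} 1+t<m = begin
      F (j + suc t)               ≡⟨ cong F (trans (block t<m) (cong (j +_) (m<n⇒m%n≡m 1+t<m))) ⟨
      F (F (F (j + t)))           ≡⟨ cong (F ∘ F) (F-block t<m) ⟩
      F (F (j + rotate m p t))    ≡⟨ block (rotate-into m p t<m) ⟩
      j + rotate m 1 (rotate m p t) ≡⟨ cong (j +_) (rotate-∘ m 1 p t) ⟩
      j + rotate m (suc p) t      ≡⟨ cong (λ x → j + x % m) (+-suc p t) ⟨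
      j + rotate m p (suc t)      ∎
      where
      t<m = <-trans (n<1+n t) 1+t<m

    p+p%m≡1 : (p + p) % m ≡ 1
    p+p%m≡1 = +-cancelˡ-≡ j _ _ (begin
      j + rotate m p p     ≡⟨ F-block p<m ⟨
      F (j + p)            ≡⟨ cong F F-j ⟨
      F (F j)              ≡⟨ cong (F ∘ F) (+-identityʳ j) ⟨
      F (F (j + 0))        ≡⟨ block (≤-trans (s≤s z≤n) 2≤m) ⟩
      j + 1 % m            ≡⟨ cong (j +_) (m<n⇒m%n≡m 2≤m) ⟩
      j + 1                ∎)

    p+p≡1+m : p + p ≡ suc m
    p+p≡1+m with p + p <? m
    ... | yes p+p<m = contradiction (trans (sym (m<n⇒m%n≡m p+p<m)) p+p%m≡1) (double≢1 p)
      where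
      double≢1 : ∀ q → q + q ≢ 1
      double≢1 (suc q) eq = 1+n≢0 (trans (sym (+-suc q q)) (suc-injective eq))
    ... | no p+p≮m = begin
      p + p              ≡⟨ m+[n∸m]≡n m≤p+p ⟨
      m + (p + p ∸ m)    ≡⟨ cong (m +_) p+p∸m≡1 ⟩
      m + 1              ≡⟨ +-comm m 1 ⟩
      suc m              ∎
      where
      m≤p+p = ≮⇒≥ p+p≮m
      p+p∸m<m : p + p ∸ m < m
      p+p∸m<m = +-cancelˡ-< m _ m (subst (_< m + m) (sym (m+[n∸m]≡n m≤p+p)) (+-mono-< p<m p<m))
      p+p∸m≡1 : p + p ∸ m ≡ 1
      p+p∸m≡1 = begin
        p + p ∸ m          ≡⟨ m<n⇒m%n≡m p+p∸m<m ⟨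
        (p + p ∸ m) % m    ≡⟨ m≤n⇒[n∸m]%m≡n%m m≤p+p ⟩
        (p + p) % m        ≡⟨ p+p%m≡1 ⟩
        1                  ∎

  m≡blockSize : ∃ λ k → m ≡ blockSize k
  m≡blockSize = let k , _ , m≡ = double≡1+m⇒blockSize {p} 2≤m p+p≡1+m in k , m≡

  F≗F⊕rotate : ∀ {k} → m ≡ blockSize k → ∀ {i} → i < j + m → F i ≡ (F ⊕[ j ] rotate m (suc (suc k))) i
  F≗F⊕rotate {k} m≡ i<j+m with split j i<j+m
  ... | inj₁ i<j = sym (⊕-< i<j)
  ... | inj₂ (t , t<m , refl) =
    trans (F-block t<m) (trans (cong (λ q → j + rotate m q t) p≡) (sym (⊕-+ j t)))
    where
    p≡ : p ≡ suc (suc k)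
    p≡ with k′ , p≡k′ , m≡k′ ← double≡1+m⇒blockSize {p} 2≤m p+p≡1+m =
      trans p≡k′ (cong (suc ∘ suc) (blockSize-injective (trans (sym m≡k′) m≡)))

-- On the block, the root is the rotation by (m + 1) / 2, the inverse of 2 modulo m.
rootWith : ℕ → ℕ → (ℕ → ℕ) → ℕ → ℕ
rootWith j k τ = τ ⊕[ j ] rotate (blockSize k) (suc (suc k))

module RootWithInvolution (j k : ℕ) {τ : ℕ → ℕ} (τ-into : MapsInto j τ)
  (τ-involutive : ∀ {i} → i < j → τ (τ i) ≡ i) where

  private
    m = blockSize k
    p = suc (suc k)
    root = rootWith j k τ
    open ≡-Reasoning

  root-into : MapsInto (j + m) root
  root-into = ⊕-into τ-into (rotate-into m p)

  root-injective : InjectiveOn (j + m) root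
  root-injective = leftInverse⇒injectiveOn (τ ⊕[ j ] rotate m (suc k)) λ {i} i<j+m → begin
    (τ ⊕[ j ] rotate m (suc k)) (root i)                ≡⟨ ⊕-∘ τ-into (rotate-into m p) i<j+m ⟩
    ((τ ∘ τ) ⊕[ j ] (rotate m (suc k) ∘ rotate m p)) i  ≡⟨ cancel i<j+m ⟩
    i                                                   ∎
    where
    cancel : ∀ {i} → i < j + m → ((τ ∘ τ) ⊕[ j ] (rotate m (suc k) ∘ rotate m p)) i ≡ i
    cancel i<j+m with split j i<j+m
    ... | inj₁ i<j = trans (⊕-< i<j) (τ-involutive i<j)
    ... | inj₂ (t , t<m , refl) = trans (⊕-+ j t) (cong (j +_) (begin
      rotate m (suc k) (rotate m p t)  ≡⟨ rotate-∘ m (suc k) p t ⟩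
      rotate m (suc k + p) t           ≡⟨ cong (λ q → rotate m q t) (blockSize-halves k) ⟩
      rotate m m t                     ≡⟨ cong (λ q → rotate m q t) (+-identityʳ m) ⟨
      rotate m (m + 0) t               ≡⟨ rotate-period m 0 t ⟩
      rotate m 0 t                     ≡⟨ m<n⇒m%n≡m t<m ⟩
      t                                ∎))

  root²-blockCycle : BlockCycle j m (root ∘ root)
  root²-blockCycle = fixed , block
    where
    fixed : ∀ {i} → i < j → root (root i) ≡ i
    fixed i<j = trans (⊕-∘ τ-into (rotate-into m p) (<-≤-trans i<j (m≤m+n j m)))
                      (trans (⊕-< i<j) (τ-involutive i<j))

    block : ∀ {t} → t < m → root (root (j + t)) ≡ j + suc t % m
    block {t} t<m = begin
      root (root (j + t))                          ≡⟨ ⊕-∘ τ-into (rotate-into m p) (+-monoʳ-< j t<m) ⟩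
      ((τ ∘ τ) ⊕[ j ] (rotate m p ∘ rotate m p)) (j + t) ≡⟨ ⊕-+ j t ⟩
      j + rotate m p (rotate m p t)                ≡⟨ cong (j +_) (rotate-∘ m p p t) ⟩
      j + rotate m (p + p) t                       ≡⟨ cong (λ q → j + rotate m (suc q) t) (blockSize-halves k) ⟩
      j + rotate m (suc m) t                       ≡⟨ cong (λ q → j + rotate m q t) (+-comm 1 m) ⟩
      j + rotate m (m + 1) t                       ≡⟨ cong (j +_) (rotate-period m 1 t) ⟩
      j + suc t % m                                ∎

-- Good permutations by the length of the nontrivial cycle of their square

blockSize≡1+double : ∀ k → blockSize k ≡ suc (2 * suc k)
blockSize≡1+double k = +-comm (2 * suc k) 1

blockSize≤⇒<half : ∀ {k n} → blockSize k ≤ suc (suc n) → k < suc n / 2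
blockSize≤⇒<half {k} {n} le = subst (_≤ suc n / 2) (m*n/n≡m (suc k) 2)
  (/-monoˡ-≤ 2 (subst (_≤ suc n) (*-comm 2 (suc k))
    (s≤s⁻¹ (subst (_≤ suc (suc n)) (blockSize≡1+double k) le))))

<half⇒blockSize≤ : ∀ {k n} → k < suc n / 2 → blockSize k ≤ suc (suc n)
<half⇒blockSize≤ {k} {n} lt = subst (_≤ suc (suc n)) (sym (blockSize≡1+double k))
  (s≤s (subst (_≤ suc n) (*-comm (suc k) 2) (≤-trans (*-monoˡ-≤ 2 lt) (m/n*n≤m (suc n) 2))))

at-involution : ∀ {j} {τ : Vec (Fin j) j} → IsInvolution τ → ∀ {i} → i < j → at τ (at τ i) ≡ i
at-involution {j} {τ} τ²≡id {i} i<j =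
  trans (sym (at-square τ i<j)) (trans (cong (λ v → at v i) τ²≡id) (at-allFin j i<j))

module Counting (n′ : ℕ) where

  n : ℕ
  n = suc (suc n′)

  cycleLength : Vec (Fin n) n → ℕ
  cycleLength π = n ∸ at (square π) (suc n′)

  open Fibres (good? n) cycleLength blockSize blockSize-injective public

  module GoodPermutation {π : Vec (Fin n) n} (π-perm : IsPerm π) (good : Good n π) where

    F : ℕ → ℕ
    F = at π

    F-into : MapsInto n F
    F-into = at< π

    F-injective : InjectiveOn n F
    F-injective = unique⇒injectiveOn π π-perm

    j : ℕ
    j = F (F (suc n′))

    tail : j ≤ n′ × IsTailCycle n′ j (F ∘ F)
    tail = soleDescentAt⇒isTailCycle (F-into ∘ F-into)
      (λ i<n i′<n → F-injective i<n i′<n ∘ F-injective (F-into i<n) (F-into i′<n))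
      (soleDescentAt-cong (at-square π) (descentsFrom≡[p+k]⇒soleDescentAt 1 n′ (square π) good))

    cycleLength≡ : cycleLength π ≡ n ∸ j
    cycleLength≡ = cong (n ∸_) (at-square π ≤-refl)

    j≤n : j ≤ n
    j≤n = ≤-trans (proj₁ tail) (≤-trans (n≤1+n n′) (n≤1+n (suc n′)))

  cycleLength-blockSize : ∀ {π} → IsPerm π → Good n π → ∃ λ k → cycleLength π ≡ blockSize k
  cycleLength-blockSize π-perm good = let k , m≡ = Root.m≡blockSize in k , trans cycleLength≡ m≡
    where
    open GoodPermutation π-perm good
    m = n ∸ j
    j+m≡n : j + m ≡ n
    j+m≡n = m+[n∸m]≡n j≤n
    2≤m : 2 ≤ m
    2≤m = subst (_≤ m) (m+n∸n≡m 2 n′) (∸-monoʳ-≤ n (proj₁ tail))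
    instance
      m-nonZero : NonZero m
      m-nonZero = >-nonZero (≤-trans (s≤s z≤n) 2≤m)
    module Root = SquareRootOfBlockCycle 2≤m
      (subst (λ x → MapsInto x F) (sym j+m≡n) F-into)
      (subst (λ x → InjectiveOn x F) (sym j+m≡n) F-injective)
      (isTailCycle⇒blockCycle m j+m≡n (proj₂ tail))

  module Fibre (k : ℕ) (m≤n : blockSize k ≤ n) where

    private
      m = blockSize k
      j = n ∸ m

      j+m≡n : j + m ≡ n
      j+m≡n = m∸n+n≡m m≤n

      j≤n′ : j ≤ n′
      j≤n′ = ∸-monoʳ-≤ n (2≤blockSize k)

      <n⇒<j+m : ∀ {i} → i < n → i < j + m
      <n⇒<j+m {i} = subst (i <_) (sym j+m≡n)

      <j⇒<n : ∀ {i} → i < j → i < n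
      <j⇒<n i<j = <-≤-trans i<j (m∸n≤m n m)

      xs = filter (inFibre? k) (perms n)
      ys = filter isInvolution? (perms j)

    restrict : Vec (Fin n) n → Vec (Fin j) j
    restrict π = fromFunction j (at π)

    extend : Vec (Fin j) j → Vec (Fin n) n
    extend τ = fromFunction n (rootWith j k (at τ))

    at-extend : ∀ τ {i} → i < n → at (extend τ) i ≡ rootWith j k (at τ) i
    at-extend τ {i} i<n = at-fromFunction n (rootWith j k (at τ)) i<n
      (subst (rootWith j k (at τ) i <_) j+m≡n (⊕-into (at< τ) (rotate-into m (suc (suc k))) (<n⇒<j+m i<n)))

    restrict-extend : ∀ τ → restrict (extend τ) ≡ τ
    restrict-extend τ = at-ext _ τ λ i<j →
      let eq = trans (at-extend τ (<j⇒<n i<j)) (⊕-< i<j)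
      in trans (at-fromFunction j _ i<j (subst (_< j) (sym eq) (at< τ i<j))) eq

    extend-injective : ∀ {τ τ′} → extend τ ≡ extend τ′ → τ ≡ τ′
    extend-injective {τ} {τ′} eq =
      trans (sym (restrict-extend τ)) (trans (cong restrict eq) (restrict-extend τ′))

    extend-into : ∀ {τ} → τ ∈ ys → extend τ ∈ xs
    extend-into {τ} τ∈ys = ∈-filter⁺ (inFibre? k) (∈-perms⁺ perm) (good , cycleLength≡blockSize)
      where
      open RootWithInvolution j k (at< τ)
        (at-involution {τ = τ} (proj₂ (∈-filter⁻ isInvolution? {xs = perms j} τ∈ys)))
      v = extend τ

      root = rootWith j k (at τ)

      at-v : ∀ {i} → i < n → at v i ≡ root i
      at-v = at-extend τ

      at-v² : ∀ {i} → i < n → at (square v) i ≡ root (root i)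
      at-v² i<n = trans (at-square v i<n) (trans (at-v (at< v i<n)) (cong root (at-v i<n)))

      tail : IsTailCycle n′ j (root ∘ root)
      tail = blockCycle⇒isTailCycle m j+m≡n root²-blockCycle

      perm : IsPerm v
      perm = injectiveOn⇒unique v λ i<n i′<n eq →
        root-injective (<n⇒<j+m i<n) (<n⇒<j+m i′<n) (trans (sym (at-v i<n)) (trans eq (at-v i′<n)))

      good : Good n v
      good = soleDescentAt⇒descentsFrom≡[p+k] 1 n′ (square v)
        (soleDescentAt-cong (sym ∘ at-v²) (isTailCycle⇒soleDescentAt j≤n′ tail))

      cycleLength≡blockSize : cycleLength v ≡ m
      cycleLength≡blockSize =
        trans (cong (n ∸_) (trans (at-v² ≤-refl) (proj₂ (proj₂ tail)))) (m∸[m∸n]≡n m≤n)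

    module _ {π} (π∈xs : π ∈ xs) where
      private
        π∈perms = proj₁ (∈-filter⁻ (inFibre? k) {xs = perms n} π∈xs)
        good = proj₁ (proj₂ (∈-filter⁻ (inFibre? k) {xs = perms n} π∈xs))
        cycleLength≡m = proj₂ (proj₂ (∈-filter⁻ (inFibre? k) {xs = perms n} π∈xs))
        open GoodPermutation (∈-perms⁻ π∈perms) good renaming (j to j′; tail to tail′)

        j′≡j : j′ ≡ j
        j′≡j = trans (sym (m∸[m∸n]≡n j≤n)) (cong (n ∸_) (trans (sym cycleLength≡) cycleLength≡m))

        blockCycle : BlockCycle j m (F ∘ F)
        blockCycle = isTailCycle⇒blockCycle m j+m≡n
          (subst (λ x → IsTailCycle n′ x (F ∘ F)) j′≡j (proj₂ tail′))

        open SquareRootOfBlockCycle (2≤blockSize k)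
          (subst (λ x → MapsInto x F) (sym j+m≡n) F-into)
          (subst (λ x → InjectiveOn x F) (sym j+m≡n) F-injective) blockCycle

        at-restrict : ∀ {i} → i < j → at (restrict π) i ≡ F i
        at-restrict i<j = at-fromFunction j F i<j (F-< i<j)

      restrict-into : restrict π ∈ ys
      restrict-into = ∈-filter⁺ isInvolution? (∈-perms⁺ perm) involutive
        where
        r = restrict π
        perm : IsPerm r
        perm = injectiveOn⇒unique r λ i<j i′<j eq →
          F-injective (<j⇒<n i<j) (<j⇒<n i′<j) (trans (sym (at-restrict i<j)) (trans eq (at-restrict i′<j)))
        involutive : IsInvolution r
        involutive = at-ext (square r) (allFin j) λ {i} i<j → begin
          at (square r) i     ≡⟨ at-square r i<j ⟩
          at r (at r i)       ≡⟨ cong (at r) (at-restrict i<j) ⟩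
          at r (F i)          ≡⟨ at-restrict (F-< i<j) ⟩
          F (F i)             ≡⟨ proj₁ blockCycle i<j ⟩
          i                   ≡⟨ at-allFin j i<j ⟨
          at (allFin j) i     ∎
          where open ≡-Reasoning

      extend-restrict : extend (restrict π) ≡ π
      extend-restrict = at-ext (extend (restrict π)) π λ {i} i<n → begin
          at (extend (restrict π)) i                   ≡⟨ at-extend (restrict π) i<n ⟩
          (at (restrict π) ⊕[ j ] rotate m (suc (suc k))) i ≡⟨ ⊕-congˡ at-restrict i ⟩
          (F ⊕[ j ] rotate m (suc (suc k))) i          ≡⟨ F≗F⊕rotate refl (<n⇒<j+m i<n) ⟨
          F i                                          ∎
        where open ≡-Reasoning

    fibre-size : length xs ≡ e j
    fibre-size = length-≡-by-bijection extend
      (Unique.filter⁺ (inFibre? k) (perms-unique n)) (Unique.filter⁺ isInvolution? (perms-unique j))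
      extend-injective extend-into λ {π} π∈xs → restrict π , restrict-into π∈xs , extend-restrict π∈xs

corollary4p3 : (n : ℕ) → 2 ≤ n → countGood n ≡ rhs n
corollary4p3 (suc zero) (s≤s ())
corollary4p3 (suc (suc n′)) _ = begin
  countGood n
    ≡⟨ length-filter≡sum-fibres (Unique.upTo⁺ K) (perms n) covered ⟩
  sum (map (λ k → length (filter (inFibre? k) (perms n))) (upTo K))
    ≡⟨ cong sum (map-cong-local (All.tabulate λ k<K →
         Fibre.fibre-size _ (<half⇒blockSize≤ (∈-upTo⁻ k<K)))) ⟩
  rhs n ∎
  where
  open ≡-Reasoning
  open Counting n′
  K = suc n′ / 2
  covered : ∀ {π} → π ∈ perms n → Good n π → ∃ λ k → k ∈ upTo K × cycleLength π ≡ blockSize k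
  covered {π} π∈perms good with k , eq ← cycleLength-blockSize (∈-perms⁻ π∈perms) good =
    k , ∈-upTo⁺ (blockSize≤⇒<half (subst (_≤ n) eq (m∸n≤m n (at (square π) (suc n′))))) , eq
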